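{- For integers $k,\ell\ge 0$, let $G$ be any blowup of $F_{k,\ell}$. Then $\chi(G)\le\lceil\frac54\omega(G)\rceil$.
   Context: Graphs are finite and simple. For integers $k,\ell\ge0$, $F_{k,\ell}$ is the graph whose vertex set is partitioned into $A$, $B$, $U$, $W$ and $\{x,y,z\}$ such that: $A=\{a_0,a_1,\ldots,a_k\}$ is a clique, $U=\{u_1,\ldots,u_k\}$ is a stable set, and the only edges between $A$ and $U$ are $a_iu_i$, $i\in\{1,\ldots,k\}$; $B=\{b_0,b_1,\ldots,b_\ell\}$ is a clique, $W=\{w_1,\ldots,w_\ell\}$ is a stable set, and the only edges between $B$ and $W$ are $b_jw_j$, $j\in\{1,\ldots,\ell\}$; $N(x)=A\cup U\cup W\cup\{y\}$; $N(y)=B\cup U\cup W\cup\{x\}$; $N(z)=A\cup B$ (and there are no other edges). A blowup of a graph $H$ is any graph $G$ whose vertex set can be partitioned into $|V(H)|$ (not necessarily non-empty) cliques $Q_v$, $v\in V(H)$, such that for distinct $u,v$, every vertex of $Q_u$ is adjacent to every vertex of $Q_v$ if $uv\in E(H)$, and no vertex of $Q_u$ is adjacent to a vertex of $Q_v$ if $uv\notin E(H)$. $\chi$ is the chromatic number and $\omega$ the clique number. -}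

module Defs where

open import Data.Nat using (ℕ; zero; suc; _+_; _*_; _≤_)
open import Data.Nat.DivMod using (_/_)
import Data.Fin as Fin
open Fin using (Fin)
open import Data.Empty using (⊥)
open import Data.Unit using () renaming (⊤ to ⊤')
open import Data.Product using (Σ; _×_; ∃)
open import Relation.Nullary using (¬_)
open import Relation.Binary.PropositionalEquality using (_≡_; _≢_)
open import Function.Bundles using (_⇔_)

record SimpleGraph (n : ℕ) : Set₁ where
  field
    Adj   : Fin n → Fin n → Set
    sym   : ∀ {x y} → Adj x y → Adj y x
    irrefl : ∀ {x} → ¬ Adj x x
open SimpleGraph public

record Clique {n : ℕ} (G : SimpleGraph n) (m : ℕ) : Set where
  field
    vert : Fin m → Fin n
    inj  : ∀ i j → vert i ≡ vert j → i ≡ j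
    adj  : ∀ i j → i ≢ j → Adj G (vert i) (vert j)

IsCliqueNumber : ∀ {n} → SimpleGraph n → ℕ → Set
IsCliqueNumber G w = Clique G w × (∀ m → Clique G m → m ≤ w)

-- proper colouring with c colours; χ(G) ≤ c iff one exists
Colouring : ∀ {n} → SimpleGraph n → ℕ → Set
Colouring {n} G c =
  Σ (Fin n → Fin c) λ f → ∀ x y → Adj G x y → f x ≢ f y

-- ⌈ 5w / 4 ⌉
ceil5/4 : ℕ → ℕ
ceil5/4 w = (5 * w + 3) / 4

-- The graph F_{k,ℓ}
-- a i  : a_i  (i = 0..k);   u j : u_{j+1} (j = 0..k-1)
-- b i  : b_i  (i = 0..ℓ);   w j : w_{j+1} (j = 0..ℓ-1)

data FV (k ℓ : ℕ) : Set where
  a : Fin (suc k) → FV k ℓ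
  u : Fin k → FV k ℓ
  b : Fin (suc ℓ) → FV k ℓ
  w : Fin ℓ → FV k ℓ
  x y z : FV k ℓ

FE : ∀ {k ℓ} → FV k ℓ → FV k ℓ → Set
FE (a i) (a j) = i ≢ j
FE (b i) (b j) = i ≢ j
FE (a i) (u j) = i ≡ Fin.suc j
FE (u j) (a i) = i ≡ Fin.suc j
FE (b i) (w j) = i ≡ Fin.suc j
FE (w j) (b i) = i ≡ Fin.suc j
FE x (a _) = ⊤'

FE (a _) x = ⊤'

FE x (u _) = ⊤'

FE (u _) x = ⊤'

FE x (w _) = ⊤'

FE (w _) x = ⊤'

FE x y = ⊤'

FE y x = ⊤'

FE y (b _) = ⊤'

FE (b _) y = ⊤'

FE y (u _) = ⊤'

FE (u _) y = ⊤'

FE y (w _) = ⊤'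

FE (w _) y = ⊤'

FE z (a _) = ⊤'

FE (a _) z = ⊤'

FE z (b _) = ⊤'

FE (b _) z = ⊤'

FE _ _ = ⊥

-- G is a blowup of F_{k,ℓ} via p : V(G) → V(F_{k,ℓ});
-- the cliques are Q_v = p⁻¹(v) (possibly empty).

IsBlowupOfF : ∀ {n} (k ℓ : ℕ) → SimpleGraph n → (Fin n → FV k ℓ) → Set
IsBlowupOfF k ℓ G p =
  ∀ v v' → v ≢ v' →
    (p v ≡ p v' → Adj G v v') ×
    (p v ≢ p v' → (Adj G v v' ⇔ FE (p v) (p v')))

module Submission where

-- Two general facts about a blowup G of any pattern graph (V, E), where the
-- weight of t ∈ V is the size of its clique Q_t:
--   * palette-colouring: if every t gets weight(t) distinct colours below c
--     and adjacent pattern vertices get disjoint colours (a Palette), then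
--     G is c-colourable (colour the vertex of rank r in Q_t by t's r-th colour);
--   * clique-bound: pairwise adjacent pattern vertices have total weight ≤ ω.

open import Defs hiding (sym)
open import Data.Nat using (ℕ; zero; suc; _+_; _*_; _∸_; _⊔_; _≤_; _<_; z≤n; s≤s; _<?_; NonZero; s≤s⁻¹)
open import Data.Nat.Properties
open import Data.Bool using (Bool; true; false; _∧_; _∨_)
import Data.Fin as Fin
open import Data.Fin using (Fin; zero; suc; toℕ; fromℕ<)
open import Data.Fin.Properties using (toℕ-injective; toℕ-fromℕ<) renaming (suc-injective to Fin-suc-injective)
open import Data.Product using (∃; _×_; _,_; proj₁; proj₂)
open import Data.Sum using (_⊎_; inj₁; inj₂)
open import Data.Sum.Properties using (≡-dec)
open import Data.Unit using (tt)
open import Data.Empty using (⊥-elim)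
open import Function using (_∘_)
open import Data.Vec.Functional using (_∷_; [])
open import Function.Bundles using (_⇔_; Equivalence; mk↣)
open import Relation.Nullary using (¬_; yes; no; does; contradiction)
open import Relation.Nullary.Decidable using (dec-true; via-injection)
open import Relation.Binary.Definitions using (DecidableEquality)
open import Relation.Binary.PropositionalEquality
  using (_≡_; _≢_; refl; sym; trans; cong; cong₂; subst; subst₂; ≢-sym)
open import Data.Nat.DivMod using (_%_; m≡m%n+[m/n]*n; m%n<n)
open import Data.Nat.Tactic.RingSolver using (solve-∀)
open import Algebra.Properties.CommutativeMonoid.Sum +-0-commutativeMonoid
  using (sum; sum-cong-≗; ∑-distrib-+; sum-replicate-zero)

-- Prefix sums.  Concatenating blocks of lengths f 0, f 1, … places
-- entry r of block i at position prefix f i + r; distinct entries land on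
-- distinct positions below the total length.

prefix : ∀ {m} → (Fin m → ℕ) → Fin m → ℕ
prefix f zero    = 0
prefix f (suc i) = f zero + prefix (f ∘ suc) i

block-bound : ∀ {m} (f : Fin m → ℕ) i {r} → r < f i → prefix f i + r < sum f
block-bound f zero    r<f = ≤-trans r<f (m≤m+n (f zero) _)
block-bound f (suc i) {r} r<f = begin-strict
  f zero + prefix (f ∘ suc) i + r   ≡⟨ +-assoc (f zero) _ r ⟩
  f zero + (prefix (f ∘ suc) i + r) <⟨ +-monoʳ-< (f zero) (block-bound (f ∘ suc) i r<f) ⟩
  f zero + sum (f ∘ suc)            ∎
  where open ≤-Reasoning

block-index-injective : ∀ {m} (f : Fin m → ℕ) i j {r r'} → r < f i → r' < f j →
  prefix f i + r ≡ prefix f j + r' → i ≡ j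
block-index-injective f zero zero _ _ _ = refl
block-index-injective f zero (suc j) {r} {r'} r<f _ e =
  contradiction e (<⇒≢ (≤-trans r<f (≤-trans (m≤m+n (f zero) _)
    (≤-reflexive (sym (+-assoc (f zero) (prefix (f ∘ suc) j) r'))))))
block-index-injective f (suc i) zero {r} _ r'<f e =
  contradiction (sym e) (<⇒≢ (≤-trans r'<f (≤-trans (m≤m+n (f zero) _)
    (≤-reflexive (sym (+-assoc (f zero) (prefix (f ∘ suc) i) r))))))
block-index-injective f (suc i) (suc j) {r} {r'} r<f r'<f e =
  cong suc (block-index-injective (f ∘ suc) i j r<f r'<f
    (+-cancelˡ-≡ (f zero) _ _ (trans (sym (+-assoc (f zero) _ r)) (trans e (+-assoc (f zero) _ r')))))

block-injective : ∀ {m} (f : Fin m → ℕ) i j {r r'} → r < f i → r' < f j →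
  prefix f i + r ≡ prefix f j + r' → i ≡ j × r ≡ r'
block-injective f i j r<f r'<f e with block-index-injective f i j r<f r'<f e
... | refl = refl , +-cancelˡ-≡ (prefix f i) _ _ e

indicator : Bool → ℕ
indicator true  = 1
indicator false = 0

count : ∀ {n} → (Fin n → Bool) → ℕ
count f = sum (indicator ∘ f)

rank : ∀ {n} → (Fin n → Bool) → Fin n → ℕ
rank f = prefix (indicator ∘ f)

indicator-pos : ∀ {b} → b ≡ true → 0 < indicator b
indicator-pos refl = s≤s z≤n

-- an element is a block of length one, so ranks are injective and below the count
rank<count : ∀ {n} (f : Fin n → Bool) v → f v ≡ true → rank f v < count f
rank<count f v fv = subst (_< count f) (+-identityʳ (rank f v))
  (block-bound (indicator ∘ f) v (indicator-pos fv))

rank-injective : ∀ {n} (f : Fin n → Bool) v v' → f v ≡ true → f v' ≡ true →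
  rank f v ≡ rank f v' → v ≡ v'
rank-injective f v v' fv fv' e = block-index-injective (indicator ∘ f) v v'
  (indicator-pos fv) (indicator-pos fv') (trans (+-identityʳ _) (trans e (sym (+-identityʳ _))))

count-∨ : ∀ {n} (f g : Fin n → Bool) → (∀ v → f v ∧ g v ≡ false) →
  count (λ v → f v ∨ g v) ≡ count f + count g
count-∨ f g disjoint = trans (sum-cong-≗ (λ v → indicator-∨ (f v) (g v) (disjoint v)))
                             (∑-distrib-+ (indicator ∘ f) (indicator ∘ g))
  where
  indicator-∨ : ∀ b b' → b ∧ b' ≡ false → indicator (b ∨ b') ≡ indicator b + indicator b'
  indicator-∨ true  false _ = refl
  indicator-∨ false b'    _ = refl

select : ∀ {n} (f : Fin n → Bool) → Fin (count f) → Fin n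
select {suc n} f i with f zero
select {suc n} f zero    | true  = zero
select {suc n} f (suc i) | true  = suc (select (f ∘ suc) i)
select {suc n} f i       | false = suc (select (f ∘ suc) i)

select-true : ∀ {n} (f : Fin n → Bool) i → f (select f i) ≡ true
select-true {suc n} f i with f zero in e
select-true {suc n} f zero    | true  = e
select-true {suc n} f (suc i) | true  = select-true (f ∘ suc) i
select-true {suc n} f i       | false = select-true (f ∘ suc) i

rank-select : ∀ {n} (f : Fin n → Bool) i → rank f (select f i) ≡ toℕ i
rank-select {suc n} f i with f zero in e
rank-select {suc n} f zero    | true  = refl
rank-select {suc n} f (suc i) | true  rewrite e = cong suc (rank-select (f ∘ suc) i)
rank-select {suc n} f i       | false rewrite e = rank-select (f ∘ suc) i

select-injective : ∀ {n} (f : Fin n → Bool) i j → select f i ≡ select f j → i ≡ j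
select-injective f i j e =
  toℕ-injective (trans (sym (rank-select f i)) (trans (cong (rank f) e) (rank-select f j)))

-- Blowups of an arbitrary pattern graph (V, E); IsBlowupOfF is the
-- instance E = FE.
IsBlowup : ∀ {V : Set} {n} → (V → V → Set) → SimpleGraph n → (Fin n → V) → Set
IsBlowup E G p = ∀ v v' → v ≢ v' →
  (p v ≡ p v' → Adj G v v') × (p v ≢ p v' → (Adj G v v' ⇔ E (p v) (p v')))

record Palette {V : Set} (E : V → V → Set) (wt : V → ℕ) (c : ℕ) : Set where
  field
    colour    : V → ℕ → ℕ
    bounded   : ∀ t {r} → r < wt t → colour t r < c
    injective : ∀ t {r r'} → r < wt t → r' < wt t → colour t r ≡ colour t r' → r ≡ r'
    separated : ∀ t t' {r r'} → E t t' → r < wt t → r' < wt t' → colour t r ≢ colour t' r'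

cons-clique : ∀ {V : Set} (E : V → V → Set) {m} {t} {f : Fin m → V} →
  (∀ i → E t (f i)) → (∀ i → E (f i) t) → (∀ i j → i ≢ j → E (f i) (f j)) →
  ∀ i j → i ≢ j → E ((t ∷ f) i) ((t ∷ f) j)
cons-clique E _   _   _        zero    zero    0≢0 = ⊥-elim (0≢0 refl)
cons-clique E t-f _   _        zero    (suc j) _   = t-f j
cons-clique E _   f-t _        (suc i) zero    _   = f-t i
cons-clique E _   _   f-clique (suc i) (suc j) i≢j = f-clique i j (i≢j ∘ cong suc)

module Blowup {V : Set} (_≟_ : DecidableEquality V) (E : V → V → Set)
  {n} (G : SimpleGraph n) (p : Fin n → V) (blowup : IsBlowup E G p) where

  inClass : V → Fin n → Bool
  inClass t v = does (p v ≟ t)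

  weight : V → ℕ
  weight t = count (inClass t)

  classRank : Fin n → ℕ
  classRank v = rank (inClass (p v)) v

  classRank<weight : ∀ v → classRank v < weight (p v)
  classRank<weight v = rank<count (inClass (p v)) v (dec-true (p v ≟ p v) refl)

  classRank-injective : ∀ v v' → p v ≡ p v' → classRank v ≡ classRank v' → v ≡ v'
  classRank-injective v v' e r = rank-injective (inClass (p v)) v v'
    (dec-true (p v ≟ p v) refl) (dec-true (p v' ≟ p v) (sym e))
    (trans r (cong (λ t → rank (inClass t) v') (sym e)))

  -- Colouring each vertex by the palette colour of its rank in its clique
  -- is proper: within a clique ranks differ, across an edge palettes differ.
  palette-colouring : ∀ {c} → Palette E weight c → Colouring G c
  palette-colouring {c} P = colourOf , proper
    where
    open Palette P
    col : Fin n → ℕ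
    col v = colour (p v) (classRank v)

    col<c : ∀ v → col v < c
    col<c v = bounded (p v) (classRank<weight v)

    colourOf : Fin n → Fin c
    colourOf v = fromℕ< (col<c v)

    same-class : ∀ v v' t → p v ≡ t → p v' ≡ t → col v ≡ col v' → v ≡ v'
    same-class v v' t refl e' eq = classRank-injective v v' (sym e')
      (injective (p v) (classRank<weight v) (subst (λ s → classRank v' < weight s) e' (classRank<weight v'))
        (trans eq (cong (λ s → colour s (classRank v')) e')))

    col-differs : ∀ v v' → Adj G v v' → col v ≢ col v'
    col-differs v v' adj eq with p v ≟ p v'
    ... | yes e = SimpleGraph.irrefl G (subst (Adj G v) (sym (same-class v v' (p v) refl (sym e) eq)) adj)
    ... | no ne = separated (p v) (p v') (Equivalence.to (proj₂ (blowup v v' v≢v') ne) adj)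
                    (classRank<weight v) (classRank<weight v') eq
      where
      v≢v' : v ≢ v'
      v≢v' e = SimpleGraph.irrefl G (subst (Adj G v) (sym e) adj)

    proper : ∀ v v' → Adj G v v' → colourOf v ≢ colourOf v'
    proper v v' adj eqF = col-differs v v' adj
      (trans (sym (toℕ-fromℕ< (col<c v))) (trans (cong toℕ eqF) (toℕ-fromℕ< (col<c v'))))

  member : ∀ {m} → (Fin m → V) → Fin n → Bool
  member {zero}  f v = false
  member {suc m} f v = inClass (f zero) v ∨ member (f ∘ suc) v

  member-class : ∀ {m} (f : Fin m → V) v → member f v ≡ true → ∃ λ i → p v ≡ f i
  member-class {suc m} f v mv with p v ≟ f zero
  ... | yes e = zero , e
  ... | no _  with member-class (f ∘ suc) v mv
  ...   | i , e = suc i , e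

  count-member : ∀ {m} (f : Fin m → V) → (∀ i j → f i ≡ f j → i ≡ j) →
    count (member f) ≡ sum (weight ∘ f)
  count-member {zero}  f f-inj = sum-replicate-zero n
  count-member {suc m} f f-inj = trans (count-∨ (inClass (f zero)) (member (f ∘ suc)) disjoint)
    (cong (weight (f zero) +_) (count-member (f ∘ suc) (λ i j e → Fin-suc-injective (f-inj (suc i) (suc j) e))))
    where
    disjoint : ∀ v → inClass (f zero) v ∧ member (f ∘ suc) v ≡ false
    disjoint v with p v ≟ f zero | member (f ∘ suc) v in mv
    ... | no _  | _     = refl
    ... | yes _ | false = refl
    ... | yes e | true with member-class (f ∘ suc) v mv
    ...   | i , e' with f-inj zero (suc i) (trans (sym e) e')
    ...     | ()

  -- A family of pairwise adjacent pattern vertices gives a clique of G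
  -- whose size is the total weight of the family.
  clique-bound : (∀ t → ¬ E t t) → ∀ {ω} → IsCliqueNumber G ω →
    ∀ {m} (f : Fin m → V) → (∀ i j → i ≢ j → E (f i) (f j)) → sum (weight ∘ f) ≤ ω
  clique-bound E-irrefl {ω} icn f adjacent =
    subst (_≤ ω) (count-member f f-inj) (proj₂ icn (count (member f)) clique)
    where
    f-inj : ∀ i j → f i ≡ f j → i ≡ j
    f-inj i j e with i Fin.≟ j
    ... | yes i≡j = i≡j
    ... | no i≢j  = ⊥-elim (E-irrefl (f j) (subst (λ t → E t (f j)) e (adjacent i j i≢j)))

    members-adjacent : ∀ v v' → v ≢ v' → member f v ≡ true → member f v' ≡ true → Adj G v v'
    members-adjacent v v' v≢v' mv mv' with member-class f v mv | member-class f v' mv' | p v ≟ p v'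
    ... | _ | _ | yes e = proj₁ (blowup v v' v≢v') e
    ... | i , e | j , e' | no ne = Equivalence.from (proj₂ (blowup v v' v≢v') ne)
      (subst₂ E (sym e) (sym e') (adjacent i j (λ i≡j → ne (trans e (trans (cong f i≡j) (sym e'))))))

    clique : Clique G (count (member f))
    clique = record
      { vert = select (member f)
      ; inj  = select-injective (member f)
      ; adj  = λ i j i≢j → members-adjacent (select (member f) i) (select (member f) j)
                 (λ e → i≢j (select-injective (member f) i j e))
                 (select-true (member f) i) (select-true (member f) j)
      }

  module Cliques (E-irrefl : ∀ t → ¬ E t t) {ω} (icn : IsCliqueNumber G ω) where

    apex-bound : ∀ {m} (f : Fin m → V) t → (∀ i j → i ≢ j → E (f i) (f j)) →
      (∀ i → E t (f i)) → (∀ i → E (f i) t) → sum (weight ∘ f) + weight t ≤ ω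
    apex-bound f t f-clique t-f f-t = subst (_≤ ω) (+-comm (weight t) _)
      (clique-bound E-irrefl icn (t ∷ f) (cons-clique E t-f f-t f-clique))

    pair-bound : ∀ {t₀ t₁} → E t₀ t₁ → E t₁ t₀ → weight t₀ + weight t₁ ≤ ω
    pair-bound {t₀} {t₁} e₀₁ e₁₀ = subst (λ m → weight t₀ + m ≤ ω) (+-identityʳ (weight t₁))
      (clique-bound E-irrefl icn (t₀ ∷ t₁ ∷ [])
        (cons-clique E (λ { zero → e₀₁ }) (λ { zero → e₁₀ }) (cons-clique E (λ ()) (λ ()) (λ ()))))

    triangle-bound : ∀ {t₀ t₁ t₂} → E t₀ t₁ → E t₁ t₀ → E t₀ t₂ → E t₂ t₀ → E t₁ t₂ → E t₂ t₁ →
      weight t₀ + weight t₁ + weight t₂ ≤ ω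
    triangle-bound {t₀} {t₁} {t₂} e₀₁ e₁₀ e₀₂ e₂₀ e₁₂ e₂₁ =
      subst (_≤ ω) (trans (cong (λ m → weight t₀ + (weight t₁ + m)) (+-identityʳ (weight t₂)))
                          (sym (+-assoc (weight t₀) _ _)))
        (clique-bound E-irrefl icn (t₀ ∷ t₁ ∷ t₂ ∷ [])
          (cons-clique E (λ { zero → e₀₁ ; (suc zero) → e₀₂ }) (λ { zero → e₁₀ ; (suc zero) → e₂₀ })
            (cons-clique E (λ { zero → e₁₂ }) (λ { zero → e₂₁ }) (cons-clique E (λ ()) (λ ()) (λ ())))))

lay : (st h R q : ℕ) → ℕ
lay st h R q with q <? h
... | yes _ = st + q
... | no  _ = R + (q ∸ h)

lay-injective : ∀ {st h R} → st + h ≤ R → ∀ q q' → lay st h R q ≡ lay st h R q' → q ≡ q'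
lay-injective {st} {h} {R} fits q q' e with q <? h | q' <? h
... | yes _   | yes _    = +-cancelˡ-≡ st q q' e
... | yes q<h | no _     = contradiction e (<⇒≢ (<-≤-trans (+-monoʳ-< st q<h) (≤-trans fits (m≤m+n R _))))
... | no _    | yes q'<h = contradiction (sym e) (<⇒≢ (<-≤-trans (+-monoʳ-< st q'<h) (≤-trans fits (m≤m+n R _))))
... | no q≮h  | no q'≮h  = ∸-cancelʳ-≡ (≮⇒≥ q≮h) (≮⇒≥ q'≮h) (+-cancelˡ-≡ R _ _ e)

InWindow : (st h R M col : ℕ) → Set
InWindow st h R M col = (st ≤ col × col < st + h) ⊎ (R ≤ col × col < R + M)

lay-window : ∀ st h R {q S} → q < S → InWindow st h R (S ∸ h) (lay st h R q)
lay-window st h R {q} q<S with q <? h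
... | yes q<h = inj₁ (m≤m+n st q , +-monoʳ-< st q<h)
... | no  q≮h = inj₂ (m≤m+n R _ , +-monoʳ-< R (∸-monoˡ-< q<S (≮⇒≥ q≮h)))

-- `skip lo hi` enumerates the naturals outside the interval [lo, hi).
skip : (lo hi r : ℕ) → ℕ
skip lo hi r with r <? lo
... | yes _ = r
... | no  _ = r + (hi ∸ lo)

skip-injective : ∀ lo hi r r' → skip lo hi r ≡ skip lo hi r' → r ≡ r'
skip-injective lo hi r r' e with r <? lo | r' <? lo
... | yes _   | yes _    = e
... | yes r<l | no r'≮l  = contradiction e (<⇒≢ (<-≤-trans r<l (≤-trans (≮⇒≥ r'≮l) (m≤m+n r' _))))
... | no r≮l  | yes r'<l = contradiction (sym e) (<⇒≢ (<-≤-trans r'<l (≤-trans (≮⇒≥ r≮l) (m≤m+n r _))))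
... | no _    | no _     = +-cancelʳ-≡ (hi ∸ lo) r r' e

skip-avoids : ∀ {lo hi q} r → lo ≤ q → q < hi → skip lo hi r ≢ q
skip-avoids {lo} {hi} {q} r lo≤q q<hi with r <? lo
... | yes r<l = <⇒≢ (<-≤-trans r<l lo≤q)
... | no  r≮l = >⇒≢ (<-≤-trans q<hi (begin
  hi                ≡⟨ sym (m+[n∸m]≡n (≤-trans lo≤q (<⇒≤ q<hi))) ⟩
  lo + (hi ∸ lo)    ≤⟨ +-monoˡ-≤ (hi ∸ lo) (≮⇒≥ r≮l) ⟩
  r + (hi ∸ lo)     ∎))
  where open ≤-Reasoning

skip-bound : ∀ {lo hi r μ m} → r < μ → μ + (hi ∸ lo) ≤ m → skip lo hi r < m
skip-bound {lo} {hi} {r} r<μ fits with r <? lo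
... | yes _ = <-≤-trans r<μ (m+n≤o⇒m≤o _ fits)
... | no  _ = <-≤-trans (+-monoˡ-< (hi ∸ lo) r<μ) fits

lay-avoids-skip : ∀ {st h R N L q} r → st + h ≤ R → q < h ⊎ (N ≤ q × q < N + L) →
  lay st h R q ≢ R + skip (N ∸ h) ((N + L) ∸ h) r
lay-avoids-skip {st} {h} {R} {N} {L} {q} r fits q-place with q <? h
... | yes q<h = <⇒≢ (<-≤-trans (+-monoʳ-< st q<h) (≤-trans fits (m≤m+n R _)))
... | no  q≮h with q-place
...   | inj₁ q<h          = contradiction q<h q≮h
...   | inj₂ (N≤q , q<NL) = λ e → skip-avoids r (∸-monoˡ-≤ h N≤q) (∸-monoˡ-< q<NL (≮⇒≥ q≮h))
                                   (sym (+-cancelˡ-≡ R _ _ e))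

excess-bound : ∀ m n o → n ≤ o → (m + n) ∸ o ≤ m
excess-bound m n o n≤o = ≤-trans (∸-monoʳ-≤ (m + n) n≤o) (≤-reflexive (m+n∸n≡m m n))

excess-removed : ∀ m n o → n ≤ o → (m ∸ ((m + n) ∸ o)) + n ≤ o
excess-removed m n o n≤o with ≤-total ((m + n) ∸ o) m
... | inj₁ e≤m = begin
  (m ∸ e) + n  ≡⟨ sym (+-∸-comm n e≤m) ⟩
  (m + n) ∸ e  ≤⟨ m≤n+o⇒m∸n≤o (m + n) e (subst (m + n ≤_) (+-comm o e) (m≤n+m∸n (m + n) o)) ⟩
  o            ∎
  where
  open ≤-Reasoning
  e = (m + n) ∸ o
... | inj₂ m≤e = subst (λ t → t + n ≤ o) (sym (m≤n⇒m∸n≡0 m≤e)) n≤o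

interval-length : ∀ N L h → ((N + L) ∸ h) ∸ (N ∸ h) ≤ L
interval-length N L h with ≤-total h N
... | inj₁ h≤N = ≤-reflexive (trans (cong (_∸ (N ∸ h)) (+-∸-comm L h≤N)) (m+n∸m≡n (N ∸ h) L))
... | inj₂ N≤h = begin
  ((N + L) ∸ h) ∸ (N ∸ h) ≡⟨ cong (((N + L) ∸ h) ∸_) (m≤n⇒m∸n≡0 N≤h) ⟩
  (N + L) ∸ h             ≤⟨ ∸-monoʳ-≤ (N + L) N≤h ⟩
  (N + L) ∸ N             ≡⟨ m+n∸m≡n N L ⟩
  L                       ∎
  where open ≤-Reasoning

-- One side of F_{k,ℓ}: a clique with classes 0..K, class suc j having a
-- partner class j (u_{j+1} or w_{j+1}) adjacent to it and to everything
-- coloured below R.  The demand of a class is the number of its colours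
-- that must go into the window [st, st+h) (below R) so that its partner
-- still fits into [R, c).
demand : ∀ {K} → (Fin (suc K) → ℕ) → (Fin K → ℕ) → (R c : ℕ) → Fin (suc K) → ℕ
demand α μ R c zero    = 0
demand α μ R c (suc j) = (α (suc j) + (μ j + R)) ∸ c

-- Colouring one side: demands are laid out first, then the remaining
-- colours class by class; the first h positions use the window and the
-- rest go above R.  A partner then skips the contiguous block of its own
-- class above R.
module Side {K : ℕ} (α : Fin (suc K) → ℕ) (μ : Fin K → ℕ) (R c st h : ℕ)
  (partner-fits : ∀ j → μ j + R ≤ c)
  (window-fits  : st + h ≤ R)
  (demand-fits  : sum (demand α μ R c) ≤ h)
  (upper-fits   : R + (sum α ∸ h) ≤ c) where

  d : Fin (suc K) → ℕ
  d = demand α μ R c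

  rest : Fin (suc K) → ℕ
  rest i = α i ∸ d i

  D : ℕ
  D = sum d

  d≤α : ∀ i → d i ≤ α i
  d≤α zero    = z≤n
  d≤α (suc j) = excess-bound (α (suc j)) (μ j + R) c (partner-fits j)

  sum-α : D + sum rest ≡ sum α
  sum-α = trans (sym (∑-distrib-+ d rest)) (sum-cong-≗ (λ i → m+[n∸m]≡n (d≤α i)))

  pos : Fin (suc K) → ℕ → ℕ
  pos i r with r <? d i
  ... | yes _ = prefix d i + r
  ... | no  _ = D + (prefix rest i + (r ∸ d i))

  pos-bound : ∀ i {r} → r < α i → pos i r < sum α
  pos-bound i {r} r<α with r <? d i
  ... | yes r<d = <-≤-trans (block-bound d i r<d) (≤-trans (m≤m+n D _) (≤-reflexive sum-α))
  ... | no  r≮d = <-≤-trans (+-monoʳ-< D (block-bound rest i (∸-monoˡ-< r<α (≮⇒≥ r≮d))))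
                             (≤-reflexive sum-α)

  pos-injective : ∀ i j {r r'} → r < α i → r' < α j → pos i r ≡ pos j r' → i ≡ j × r ≡ r'
  pos-injective i j {r} {r'} r<α r'<α e with r <? d i | r' <? d j
  ... | yes r<d | yes r'<d = block-injective d i j r<d r'<d e
  ... | yes r<d | no _     = contradiction e (<⇒≢ (<-≤-trans (block-bound d i r<d) (m≤m+n D _)))
  ... | no _    | yes r'<d = contradiction (sym e) (<⇒≢ (<-≤-trans (block-bound d j r'<d) (m≤m+n D _)))
  ... | no r≮d  | no r'≮d
    with block-injective rest i j (∸-monoˡ-< r<α (≮⇒≥ r≮d)) (∸-monoˡ-< r'<α (≮⇒≥ r'≮d))
                         (+-cancelˡ-≡ D _ _ e)
  ...   | refl , e' = refl , ∸-cancelʳ-≡ (≮⇒≥ r≮d) (≮⇒≥ r'≮d) e'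

  blockStart : Fin K → ℕ
  blockStart j = D + prefix rest (suc j)

  partner-class-position : ∀ j {r} → r < α (suc j) →
    pos (suc j) r < h ⊎ (blockStart j ≤ pos (suc j) r × pos (suc j) r < blockStart j + rest (suc j))
  partner-class-position j {r} r<α with r <? d (suc j)
  ... | yes r<d = inj₁ (<-≤-trans (block-bound d (suc j) r<d) demand-fits)
  ... | no  r≮d = inj₂ (≤-trans (m≤m+n (blockStart j) _) (≤-reflexive (+-assoc D _ _))
                       , ≤-<-trans (≤-reflexive (sym (+-assoc D _ _)))
                                   (+-monoʳ-< (blockStart j) (∸-monoˡ-< r<α (≮⇒≥ r≮d))))

  colA : Fin (suc K) → ℕ → ℕ
  colA i r = lay st h R (pos i r)

  colU : Fin K → ℕ → ℕ
  colU j r = R + skip (blockStart j ∸ h) ((blockStart j + rest (suc j)) ∸ h) r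

  colA-injective : ∀ i j {r r'} → r < α i → r' < α j → colA i r ≡ colA j r' → i ≡ j × r ≡ r'
  colA-injective i j r<α r'<α e = pos-injective i j r<α r'<α (lay-injective {st} {h} {R} window-fits _ _ e)

  colA-window : ∀ i {r} → r < α i → InWindow st h R (sum α ∸ h) (colA i r)
  colA-window i r<α = lay-window st h R (pos-bound i r<α)

  colA-bound : ∀ i {r} → r < α i → colA i r < c
  colA-bound i r<α with colA-window i r<α
  ... | inj₁ (_ , below) = <-≤-trans below (≤-trans window-fits (m+n≤o⇒m≤o R upper-fits))
  ... | inj₂ (_ , below) = <-≤-trans below upper-fits

  colU-above : ∀ j r → R ≤ colU j r
  colU-above j r = m≤m+n R _

  colU-injective : ∀ j r r' → colU j r ≡ colU j r' → r ≡ r'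
  colU-injective j r r' e = skip-injective (blockStart j ∸ h) _ r r' (+-cancelˡ-≡ R _ _ e)

  colU-bound : ∀ j {r} → r < μ j → colU j r < c
  colU-bound j {r} r<μ = <-≤-trans (+-monoʳ-< R (skip-bound {lo} {hi} r<μ room))
                                   (≤-reflexive (m+[n∸m]≡n R≤c))
    where
    lo = blockStart j ∸ h
    hi = (blockStart j + rest (suc j)) ∸ h
    R≤c : R ≤ c
    R≤c = m+n≤o⇒m≤o R upper-fits
    room : μ j + (hi ∸ lo) ≤ c ∸ R
    room = m+n≤o⇒m≤o∸n (μ j + _) (begin
      μ j + (hi ∸ lo) + R           ≤⟨ +-monoˡ-≤ R (+-monoʳ-≤ (μ j) (interval-length (blockStart j) (rest (suc j)) h)) ⟩
      μ j + rest (suc j) + R        ≡⟨ cong (_+ R) (+-comm (μ j) (rest (suc j))) ⟩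
      rest (suc j) + μ j + R        ≡⟨ +-assoc (rest (suc j)) (μ j) R ⟩
      rest (suc j) + (μ j + R)      ≤⟨ excess-removed (α (suc j)) (μ j + R) c (partner-fits j) ⟩
      c                             ∎)
      where open ≤-Reasoning

  colU-avoids : ∀ j {r r'} → r' < α (suc j) → colU j r ≢ colA (suc j) r'
  colU-avoids j {r} r'<α e = lay-avoids-skip r window-fits (partner-class-position j r'<α) (sym e)

-- The colour budget is c = ω + s
-- with ω ≤ 4s.  A class with positive demand dm must, by the cliques
-- {a_i, u_i, x} and {x, y, u_i}, satisfy dm + s ≤ its weight and
-- dm + s ≤ Q' (the weight of the helper class y, resp. x).

halve : ∀ {m n} → m + m ≤ n + n → m ≤ n
halve m+m≤n+n = ≮⇒≥ (λ n<m → <⇒≱ (+-mono-< n<m n<m) m+m≤n+n)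

class-demand : ∀ {α μ Q Q' R ω} s → α + μ + Q ≤ ω → μ + R ≤ ω → R ≤ Q + Q' →
  (α + (μ + R)) ∸ (ω + s) ≡ 0 ⊎
  ((α + (μ + R)) ∸ (ω + s) + s ≤ α × (α + (μ + R)) ∸ (ω + s) + s ≤ Q')
class-demand {α} {μ} {Q} {Q'} {R} {ω} s triangle partner R≤ with ≤-total (α + (μ + R)) (ω + s)
... | inj₁ fits = inj₁ (m≤n⇒m∸n≡0 fits)
... | inj₂ over = inj₂ (+-cancelʳ-≤ ω _ _ own , +-cancelʳ-≤ ω _ _ helper)
  where
  open ≤-Reasoning
  dm = (α + (μ + R)) ∸ (ω + s)
  dm+s+ω : dm + s + ω ≡ α + (μ + R)
  dm+s+ω = trans (trans (+-assoc dm s ω) (cong (dm +_) (+-comm s ω))) (m∸n+n≡m over)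
  own : dm + s + ω ≤ α + ω
  own = begin
    dm + s + ω   ≡⟨ dm+s+ω ⟩
    α + (μ + R)  ≤⟨ +-monoʳ-≤ α partner ⟩
    α + ω        ∎
  helper : dm + s + ω ≤ Q' + ω
  helper = begin
    dm + s + ω             ≡⟨ dm+s+ω ⟩
    α + (μ + R)            ≤⟨ +-monoʳ-≤ α (+-monoʳ-≤ μ R≤) ⟩
    α + (μ + (Q + Q'))     ≡⟨ rearrange α μ Q Q' ⟩
    (α + μ + Q) + Q'       ≤⟨ +-monoˡ-≤ Q' triangle ⟩
    ω + Q'                 ≡⟨ +-comm ω Q' ⟩
    Q' + ω                 ∎
    where
    rearrange : ∀ m n o p → m + (n + (o + p)) ≡ m + n + o + p
    rearrange = solve-∀

-- Summing the class inequalities: P counts the classes of positive demand.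
demand-total : ∀ {m} (dm α : Fin m → ℕ) {s Q'} →
  (∀ i → dm i ≡ 0 ⊎ (dm i + s ≤ α i × dm i + s ≤ Q')) →
  ∃ λ P → sum dm + P * s ≤ sum α × sum dm + P * s ≤ P * Q'
demand-total {zero}  dm α per-class = 0 , z≤n , z≤n
demand-total {suc m} dm α {s} {Q'} per-class with demand-total (dm ∘ suc) (α ∘ suc) (per-class ∘ suc)
... | P , ≤α , ≤Q' with per-class zero
...   | inj₁ d₀≡0 = P
        , subst (λ t → t + sum (dm ∘ suc) + P * s ≤ sum α) (sym d₀≡0) (≤-trans ≤α (m≤n+m _ (α zero)))
        , subst (λ t → t + sum (dm ∘ suc) + P * s ≤ P * Q') (sym d₀≡0) ≤Q'
...   | inj₂ (d₀≤α , d₀≤Q') = suc P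
        , ≤-trans (≤-reflexive (regroup (dm zero) _ s (P * s))) (+-mono-≤ d₀≤α ≤α)
        , ≤-trans (≤-reflexive (regroup (dm zero) _ s (P * s))) (+-mono-≤ d₀≤Q' ≤Q')
  where
  regroup : ∀ d S s' Ps → d + S + (s' + Ps) ≡ d + s' + (S + Ps)
  regroup = solve-∀

record DemandBudget (SA SB Z Y ω s : ℕ) : Set where
  field
    side+z      : SA + Z ≤ ω
    other+z     : SB + Z ≤ ω
    other+helper : SB + Y ≤ ω
    ω≤4s        : ω ≤ 4 * s

module DemandCases {SA SB Z Y ω s : ℕ} (budget : DemandBudget SA SB Z Y ω s) where
  open DemandBudget budget
  open ≤-Reasoning

  private
    SA≤ω : SA ≤ ω
    SA≤ω = m+n≤o⇒m≤o SA side+z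

    Z+SB≤ω : Z + SB ≤ ω
    Z+SB≤ω = subst (_≤ ω) (+-comm SB Z) other+z

  no-demanding-class : ∀ {D} → D + 0 ≤ 0 → D ≤ Y × Z + SB + D ≤ ω + s
  no-demanding-class {D} hY with n≤0⇒n≡0 (m+n≤o⇒m≤o D hY)
  ... | refl = z≤n , ≤-trans (≤-reflexive (+-identityʳ (Z + SB))) (≤-trans Z+SB≤ω (m≤m+n ω s))

  -- one: add the cliques B+z, B+y, A+z and use ω ≤ 4s
  one-demanding-class : ∀ {D} → D + s ≤ SA → D + s ≤ Y → D ≤ Y × Z + SB + D ≤ ω + s
  one-demanding-class {D} hA hY = ≤-trans (m≤m+n D s) hY , +-cancelʳ-≤ (s + s) _ _ (halve (begin
      T + (s + s) + (T + (s + s))                         ≡⟨ regroup Z SB D s ⟩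
      (SB + Z) + (SB + (D + s)) + (Z + (D + s)) + (s + s) ≤⟨ +-monoˡ-≤ (s + s) three-cliques ⟩
      ω + ω + ω + (s + s)                                 ≤⟨ +-monoˡ-≤ (s + s) (+-monoʳ-≤ (ω + ω) ω≤4s) ⟩
      ω + ω + 4 * s + (s + s)                             ≡⟨ regroup′ ω s ⟩
      ω + s + (s + s) + (ω + s + (s + s))                 ∎))
    where
    T = Z + SB + D
    three-cliques : (SB + Z) + (SB + (D + s)) + (Z + (D + s)) ≤ ω + ω + ω
    three-cliques = +-mono-≤ (+-mono-≤ other+z (≤-trans (+-monoʳ-≤ SB hY) other+helper))
                             (≤-trans (+-monoʳ-≤ Z hA) (≤-trans (≤-reflexive (+-comm Z SA)) side+z))
    regroup : ∀ z′ b′ d′ s′ → z′ + b′ + d′ + (s′ + s′) + (z′ + b′ + d′ + (s′ + s′))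
                           ≡ (b′ + z′) + (b′ + (d′ + s′)) + (z′ + (d′ + s′)) + (s′ + s′)
    regroup = solve-∀
    regroup′ : ∀ w′ s′ → w′ + w′ + 4 * s′ + (s′ + s′) ≡ w′ + s′ + (s′ + s′) + (w′ + s′ + (s′ + s′))
    regroup′ = solve-∀

  -- two: averaging gives D ≤ Y, and s ≤ Y leaves room for B
  two-demanding-classes : ∀ {D} → D + 2 * s ≤ SA → D + 2 * s ≤ 2 * Y → D ≤ Y × Z + SB + D ≤ ω + s
  two-demanding-classes {D} hA hY = D≤Y , +-cancelʳ-≤ (2 * s + Y) _ _ (begin
      Z + SB + D + (2 * s + Y)      ≡⟨ regroup Z SB D s Y ⟩
      (Z + (D + 2 * s)) + (SB + Y)  ≤⟨ +-mono-≤ (≤-trans (+-monoʳ-≤ Z hA) (≤-trans (≤-reflexive (+-comm Z SA)) side+z))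
                                               other+helper ⟩
      ω + ω                         ≤⟨ +-monoʳ-≤ ω ω≤4s ⟩
      ω + 4 * s                     ≡⟨ regroup′ ω s ⟩
      ω + s + (2 * s + s)           ≤⟨ +-monoʳ-≤ (ω + s) (+-monoʳ-≤ (2 * s) s≤Y) ⟩
      ω + s + (2 * s + Y)           ∎)
    where
    D≤Y : D ≤ Y
    D≤Y = halve (+-cancelʳ-≤ (4 * s) _ _ (begin
      D + D + 4 * s             ≡⟨ double D s ⟩
      D + 2 * s + (D + 2 * s)   ≤⟨ +-mono-≤ hA hY ⟩
      SA + 2 * Y                ≤⟨ +-monoˡ-≤ (2 * Y) (≤-trans SA≤ω ω≤4s) ⟩
      4 * s + 2 * Y             ≡⟨ +-comm (4 * s) (2 * Y) ⟩
      2 * Y + 4 * s             ≡⟨ cong (_+ 4 * s) (cong (Y +_) (+-identityʳ Y)) ⟩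
      Y + Y + 4 * s             ∎))
      where
      double : ∀ d′ s′ → d′ + d′ + 4 * s′ ≡ d′ + 2 * s′ + (d′ + 2 * s′)
      double = solve-∀
    s≤Y : s ≤ Y
    s≤Y = halve (≤-trans (≤-reflexive (cong (s +_) (sym (+-identityʳ s))))
                (≤-trans (m≤n+m (2 * s) D) (≤-trans hY (≤-reflexive (cong (Y +_) (+-identityʳ Y))))))
    regroup : ∀ z′ b′ d′ s′ y′ → z′ + b′ + d′ + (2 * s′ + y′) ≡ (z′ + (d′ + 2 * s′)) + (b′ + y′)
    regroup = solve-∀
    regroup′ : ∀ w′ s′ → w′ + 4 * s′ ≡ w′ + s′ + (2 * s′ + s′)
    regroup′ = solve-∀

  -- three or more: D ≤ s ≤ Y, since A has weight at most ω ≤ 4s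
  many-demanding-classes : ∀ {D} P .{{_ : NonZero P}} → 3 ≤ P → D + P * s ≤ SA → D + P * s ≤ P * Y →
    D ≤ Y × Z + SB + D ≤ ω + s
  many-demanding-classes {D} P 3≤P hA hY = ≤-trans D≤s s≤Y , +-mono-≤ Z+SB≤ω D≤s
    where
    D≤s : D ≤ s
    D≤s = +-cancelʳ-≤ (3 * s) _ _ (begin
      D + 3 * s   ≤⟨ +-monoʳ-≤ D (*-monoˡ-≤ s 3≤P) ⟩
      D + P * s   ≤⟨ hA ⟩
      SA          ≤⟨ ≤-trans SA≤ω ω≤4s ⟩
      4 * s       ≡⟨ split s ⟩
      s + 3 * s   ∎)
      where
      split : ∀ s′ → 4 * s′ ≡ s′ + 3 * s′
      split = solve-∀
    s≤Y : s ≤ Y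
    s≤Y = *-cancelˡ-≤ P (≤-trans (m≤n+m (P * s) D) hY)

  total-demand : ∀ {D} P → D + P * s ≤ SA → D + P * s ≤ P * Y → D ≤ Y × Z + SB + D ≤ ω + s
  total-demand zero                   hA hY = no-demanding-class hY
  total-demand (suc zero)             hA hY =
    one-demanding-class (subst (λ t → _ + t ≤ SA) (*-identityˡ s) hA)
                        (subst₂ (λ t t′ → _ + t ≤ t′) (*-identityˡ s) (*-identityˡ Y) hY)
  total-demand (suc (suc zero))       hA hY = two-demanding-classes hA hY
  total-demand P@(suc (suc (suc _))) hA hY = many-demanding-classes P (s≤s (s≤s (s≤s z≤n))) hA hY

side-demand : ∀ {K} (α : Fin (suc K) → ℕ) (μ : Fin K → ℕ) {Q Q' R S' Z ω s} →
  (∀ j → α (suc j) + μ j + Q ≤ ω) → (∀ j → μ j + R ≤ ω) → R ≤ Q + Q' →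
  DemandBudget (sum α) S' Z Q' ω s →
  sum (demand α μ R (ω + s)) ≤ sum α × sum (demand α μ R (ω + s)) ≤ Q'
    × Z + S' + sum (demand α μ R (ω + s)) ≤ ω + s
side-demand α μ {Q} {Q'} {R} {S'} {Z} {ω} {s} triangle partner R≤ budget =
  m+n≤o⇒m≤o _ ≤α , DemandCases.total-demand budget P ≤α ≤Q'
  where
  dm : Fin _ → ℕ
  dm = demand α μ R (ω + s)
  per-class : ∀ i → dm i ≡ 0 ⊎ (dm i + s ≤ α i × dm i + s ≤ Q')
  per-class zero    = inj₁ refl
  per-class (suc j) = class-demand s (triangle j) (partner j) R≤
  P : ℕ
  P = proj₁ (demand-total dm α per-class)
  ≤α : sum dm + P * s ≤ sum α
  ≤α = proj₁ (proj₂ (demand-total dm α per-class))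
  ≤Q' : sum dm + P * s ≤ P * Q'
  ≤Q' = proj₂ (proj₂ (demand-total dm α per-class))

-- The window of a side: share D S R c colours of a side of total weight S
-- go below R, enough for its demand D and enough for the rest of the side
-- to fit into [R, c).
share : (D S R c : ℕ) → ℕ
share D S R c = D ⊔ ((S + R) ∸ c)

share-below-helper : ∀ {D S R c Q Q'} → S + Q ≤ c → R ≤ Q + Q' → D ≤ Q' → share D S R c ≤ Q'
share-below-helper {D} {S} {R} {c} {Q} {Q'} S+Q≤c R≤ D≤Q' =
  ⊔-lub D≤Q' (m≤n+o⇒m∸n≤o (S + R) c (begin
    S + R          ≤⟨ +-monoʳ-≤ S R≤ ⟩
    S + (Q + Q')   ≡⟨ sym (+-assoc S Q Q') ⟩
    S + Q + Q'     ≤⟨ +-monoˡ-≤ Q' S+Q≤c ⟩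
    c + Q'         ∎))
  where open ≤-Reasoning

share-below-side : ∀ {D S R c} → D ≤ S → R ≤ c → share D S R c ≤ S
share-below-side {D} {S} {R} {c} D≤S R≤c = ⊔-lub D≤S (excess-bound S R c R≤c)

share-leaves-room : ∀ {D S R c} → R ≤ c → R + (S ∸ share D S R c) ≤ c
share-leaves-room {D} {S} {R} {c} R≤c = begin
  R + (S ∸ share D S R c)        ≤⟨ +-monoʳ-≤ R (∸-monoʳ-≤ S (m≤n⊔m D _)) ⟩
  R + (S ∸ ((S + R) ∸ c))        ≡⟨ +-comm R _ ⟩
  (S ∸ ((S + R) ∸ c)) + R        ≤⟨ excess-removed S R c R≤c ⟩
  c                              ∎
  where open ≤-Reasoning

share-with-other : ∀ {D S R c Z S'} → Z + S' + D ≤ c → Z + S' + (S + R) ≤ c + c →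
  Z + S' + share D S R c ≤ c
share-with-other {D} {S} {R} {c} {Z} {S'} with-demand with-all =
  subst (_≤ c) (sym (+-distribˡ-⊔ (Z + S') D _)) (⊔-lub with-demand with-excess)
  where
  with-excess : Z + S' + ((S + R) ∸ c) ≤ c
  with-excess with ≤-total (S + R) c
  ... | inj₁ fits = subst (λ t → Z + S' + t ≤ c) (sym (m≤n⇒m∸n≡0 fits))
                          (≤-trans (+-monoʳ-≤ (Z + S') z≤n) with-demand)
  ... | inj₂ over = +-cancelʳ-≤ c _ _ (begin
    Z + S' + ((S + R) ∸ c) + c  ≡⟨ +-assoc (Z + S') _ c ⟩
    Z + S' + ((S + R) ∸ c + c)  ≡⟨ cong (Z + S' +_) (m∸n+n≡m over) ⟩
    Z + S' + (S + R)            ≤⟨ with-all ⟩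
    c + c                       ∎)
    where open ≤-Reasoning

-- The five cliques A+z, B+z, A+x, B+y and {x, y} together bound the total
-- weight of F by 5ω/2 ≤ 2c.
five-cliques : ∀ {S S' Z Q Q' R ω s} → S + Z ≤ ω → S' + Z ≤ ω → S + Q ≤ ω → S' + Q' ≤ ω →
  Q + Q' ≤ ω → R ≤ Q + Q' → ω ≤ 4 * s → Z + S' + (S + R) ≤ (ω + s) + (ω + s)
five-cliques {S} {S'} {Z} {Q} {Q'} {R} {ω} {s} h₁ h₂ h₃ h₄ h₅ R≤ ω≤4s = halve (begin
  T + T                                                     ≤⟨ +-mono-≤ T≤ T≤ ⟩
  U + U                                                     ≡⟨ regroup Z S' S Q Q' ⟩
  (S + Z) + (S' + Z) + (S + Q) + (S' + Q') + (Q + Q')       ≤⟨ +-mono-≤ (+-mono-≤ (+-mono-≤ (+-mono-≤ h₁ h₂) h₃) h₄) h₅ ⟩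
  ω + ω + ω + ω + ω                                         ≤⟨ +-monoʳ-≤ (ω + ω + ω + ω) ω≤4s ⟩
  ω + ω + ω + ω + 4 * s                                     ≡⟨ regroup′ ω s ⟩
  (ω + s) + (ω + s) + ((ω + s) + (ω + s))                   ∎)
  where
  open ≤-Reasoning
  T = Z + S' + (S + R)
  U = Z + S' + (S + (Q + Q'))
  T≤ : T ≤ U
  T≤ = +-monoʳ-≤ (Z + S') (+-monoʳ-≤ S R≤)
  regroup : ∀ z′ b′ a′ q q′ → z′ + b′ + (a′ + (q + q′)) + (z′ + b′ + (a′ + (q + q′)))
                            ≡ (a′ + z′) + (b′ + z′) + (a′ + q) + (b′ + q′) + (q + q′)
  regroup = solve-∀
  regroup′ : ∀ w′ s′ → w′ + w′ + w′ + w′ + 4 * s′ ≡ (w′ + s′) + (w′ + s′) + ((w′ + s′) + (w′ + s′))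
  regroup′ = solve-∀

windows-disjoint : ∀ {st h R M st' h' R' M' col col'} →
  InWindow st h R M col → InWindow st' h' R' M' col' →
  st + h ≤ st' ⊎ st' + h' ≤ st → st + h ≤ R' → st' + h' ≤ R → R + M ≤ R' → col ≢ col'
windows-disjoint (inj₁ (_ , ub)) (inj₁ (lb' , _)) (inj₁ low≤) _ _ _ = <⇒≢ (<-≤-trans ub (≤-trans low≤ lb'))
windows-disjoint (inj₁ (lb , _)) (inj₁ (_ , ub')) (inj₂ low≤) _ _ _ = >⇒≢ (<-≤-trans ub' (≤-trans low≤ lb))
windows-disjoint (inj₁ (_ , ub)) (inj₂ (lb' , _)) _ low≤high' _ _ = <⇒≢ (<-≤-trans ub (≤-trans low≤high' lb'))
windows-disjoint (inj₂ (lb , _)) (inj₁ (_ , ub')) _ _ low'≤high _ = >⇒≢ (<-≤-trans ub' (≤-trans low'≤high lb))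
windows-disjoint (inj₂ (_ , ub)) (inj₂ (lb' , _)) _ _ _ high≤high' = <⇒≢ (<-≤-trans ub (≤-trans high≤high' lb'))

window-above-start : ∀ {st h R M col} → InWindow st h R M col → st ≤ R → st ≤ col
window-above-start (inj₁ (lb , _)) _    = lb
window-above-start (inj₂ (lb , _)) st≤R = ≤-trans st≤R lb

window-avoids : ∀ {st h R M col lo hi col'} → InWindow st h R M col →
  st + h ≤ lo → hi ≤ R → lo ≤ col' → col' < hi → col ≢ col'
window-avoids (inj₁ (_ , ub)) low≤lo _ lo≤col' _ = <⇒≢ (<-≤-trans ub (≤-trans low≤lo lo≤col'))
window-avoids (inj₂ (lb , _)) _ hi≤R _ col'<hi   = >⇒≢ (<-≤-trans col'<hi (≤-trans hi≤R lb))

ceil5/4-spec : ∀ ω → 5 * ω ≤ 4 * ceil5/4 ω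
ceil5/4-spec ω = +-cancelʳ-≤ 3 _ _ (begin
  5 * ω + 3                ≡⟨ m≡m%n+[m/n]*n (5 * ω + 3) 4 ⟩
  (5 * ω + 3) % 4 + q * 4  ≤⟨ +-monoˡ-≤ (q * 4) (s≤s⁻¹ (m%n<n (5 * ω + 3) 4)) ⟩
  3 + q * 4                ≡⟨ +-comm 3 (q * 4) ⟩
  q * 4 + 3                ≡⟨ cong (_+ 3) (*-comm q 4) ⟩
  4 * q + 3                ∎)
  where
  open ≤-Reasoning
  q = ceil5/4 ω

slack : ℕ → ℕ
slack ω = ceil5/4 ω ∸ ω

ω≤ceil5/4 : ∀ ω → ω ≤ ceil5/4 ω
ω≤ceil5/4 ω = *-cancelˡ-≤ 4 (≤-trans (*-monoˡ-≤ ω (n≤1+n 4)) (ceil5/4-spec ω))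

budget-split : ∀ ω → ω + slack ω ≡ ceil5/4 ω
budget-split ω = m+[n∸m]≡n (ω≤ceil5/4 ω)

ω≤4*slack : ∀ ω → ω ≤ 4 * slack ω
ω≤4*slack ω = +-cancelˡ-≤ (4 * ω) _ _ (begin
  4 * ω + ω            ≡⟨ +-comm (4 * ω) ω ⟩
  5 * ω                ≤⟨ ceil5/4-spec ω ⟩
  4 * ceil5/4 ω        ≡⟨ cong (4 *_) (sym (budget-split ω)) ⟩
  4 * (ω + slack ω)    ≡⟨ *-distribˡ-+ 4 ω (slack ω) ⟩
  4 * ω + 4 * slack ω  ∎)
  where open ≤-Reasoning

-- The high colours of a side lie below the top block [c ∸ (Z ∸ hz), c) of z,
-- where z also uses a low block of size hz and R = hz + (h + h') splits the
-- low colours between z, this side (h) and the other side (h').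
below-z-top : ∀ {R S h h' hz Z c} → R ≡ hz + (h + h') → h ≤ S → R + (S ∸ h) ≤ c →
  Z + S + h' ≤ c → R + (S ∸ h) + (Z ∸ hz) ≤ c
below-z-top {R} {S} {h} {h'} {hz} {Z} {c} R≡ h≤S room with-z with ≤-total Z hz
... | inj₁ Z≤hz = subst (λ t → R + (S ∸ h) + t ≤ c) (sym (m≤n⇒m∸n≡0 Z≤hz))
                        (≤-trans (≤-reflexive (+-identityʳ _)) room)
... | inj₂ hz≤Z = +-cancelʳ-≤ hz _ _ (begin
  R + (S ∸ h) + (Z ∸ hz) + hz      ≡⟨ +-assoc (R + (S ∸ h)) _ hz ⟩
  R + (S ∸ h) + ((Z ∸ hz) + hz)    ≡⟨ cong₂ (λ r t → r + (S ∸ h) + t) R≡ (m∸n+n≡m hz≤Z) ⟩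
  hz + (h + h') + (S ∸ h) + Z      ≡⟨ regroup hz h h' (S ∸ h) Z ⟩
  Z + (h + (S ∸ h)) + h' + hz      ≡⟨ cong (λ t → Z + t + h' + hz) (m+[n∸m]≡n h≤S) ⟩
  Z + S + h' + hz                  ≤⟨ +-monoˡ-≤ hz with-z ⟩
  c + hz                           ∎)
  where
  open ≤-Reasoning
  regroup : ∀ z′ h₁ h₂ r z″ → z′ + (h₁ + h₂) + r + z″ ≡ z″ + (h₁ + r) + h₂ + z′
  regroup = solve-∀

record CliqueBounds {k ℓ} (wt : FV k ℓ → ℕ) (ω : ℕ) : Set where
  field
    A+z   : sum (wt ∘ a) + wt z ≤ ω
    A+x   : sum (wt ∘ a) + wt x ≤ ω
    B+z   : sum (wt ∘ b) + wt z ≤ ω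
    B+y   : sum (wt ∘ b) + wt y ≤ ω
    x+y   : wt x + wt y ≤ ω
    a-u-x : ∀ j → wt (a (suc j)) + wt (u j) + wt x ≤ ω
    u-x-y : ∀ j → wt (u j) + (wt x + wt y) ≤ ω
    b-w-y : ∀ j → wt (b (suc j)) + wt (w j) + wt y ≤ ω
    w-x-y : ∀ j → wt (w j) + (wt x + wt y) ≤ ω

-- Colours:
--   x : [0, X)          y : [X, R),  R = X + Y
--   A : a window of hA colours at the top of y's range, the rest from R up
--   B : a window of hB colours at the bottom of x's range, the rest from R up
--   u_j, w_j : from R up, skipping the high colours of their partner class
--   z : the colours [hB, R - hA) left between the windows, then a top block.
module FColouring {k ℓ} (wt : FV k ℓ → ℕ) {ω s : ℕ} (ω≤4s : ω ≤ 4 * s)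
  (bounds : CliqueBounds wt ω) where
  open CliqueBounds bounds

  X Y Z R c SA SB : ℕ
  X  = wt x
  Y  = wt y
  Z  = wt z
  R  = X + Y
  c  = ω + s
  SA = sum (wt ∘ a)
  SB = sum (wt ∘ b)

  ω≤c : ω ≤ c
  ω≤c = m≤m+n ω s

  R≤c : R ≤ c
  R≤c = ≤-trans x+y ω≤c

  R≤Y+X : R ≤ Y + X
  R≤Y+X = ≤-reflexive (+-comm X Y)

  DA DB : ℕ
  DA = sum (demand (wt ∘ a) (wt ∘ u) R c)
  DB = sum (demand (wt ∘ b) (wt ∘ w) R c)

  demand-A : DA ≤ SA × DA ≤ Y × Z + SB + DA ≤ c
  demand-A = side-demand (wt ∘ a) (wt ∘ u) a-u-x u-x-y ≤-refl
    (record { side+z = A+z ; other+z = B+z ; other+helper = B+y ; ω≤4s = ω≤4s })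

  demand-B : DB ≤ SB × DB ≤ X × Z + SA + DB ≤ c
  demand-B = side-demand (wt ∘ b) (wt ∘ w) b-w-y w-x-y R≤Y+X
    (record { side+z = B+z ; other+z = A+z ; other+helper = A+x ; ω≤4s = ω≤4s })

  hA hB : ℕ
  hA = share DA SA R c
  hB = share DB SB R c

  hA≤Y : hA ≤ Y
  hA≤Y = share-below-helper {DA} {SA} {R} {c} {X} {Y} (≤-trans A+x ω≤c) ≤-refl (proj₁ (proj₂ demand-A))

  hB≤X : hB ≤ X
  hB≤X = share-below-helper {DB} {SB} {R} {c} {Y} {X} (≤-trans B+y ω≤c) R≤Y+X (proj₁ (proj₂ demand-B))

  Z+SB+hA≤c : Z + SB + hA ≤ c
  Z+SB+hA≤c = share-with-other {DA} {SA} {R} {c} {Z} {SB} (proj₂ (proj₂ demand-A))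
    (five-cliques {SA} {SB} {Z} {X} {Y} {R} A+z B+z A+x B+y x+y ≤-refl ω≤4s)

  Z+SA+hB≤c : Z + SA + hB ≤ c
  Z+SA+hB≤c = share-with-other {DB} {SB} {R} {c} {Z} {SA} (proj₂ (proj₂ demand-B))
    (five-cliques {SB} {SA} {Z} {Y} {X} {R} B+z A+z B+y A+x (subst (_≤ ω) (+-comm X Y) x+y) R≤Y+X ω≤4s)

  stA hz : ℕ
  stA = X + (Y ∸ hA)
  hz  = stA ∸ hB

  stA+hA : stA + hA ≡ R
  stA+hA = trans (+-assoc X _ hA) (cong (X +_) (m∸n+n≡m hA≤Y))

  hB+hz : hB + hz ≡ stA
  hB+hz = m+[n∸m]≡n (≤-trans hB≤X (m≤m+n X _))

  stA≤R : stA ≤ R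
  stA≤R = ≤-trans (m≤m+n stA hA) (≤-reflexive stA+hA)

  R-split : R ≡ hz + (hA + hB)
  R-split = trans (sym stA+hA) (trans (cong (_+ hA) (sym hB+hz)) (regroup hB hz hA))
    where
    regroup : ∀ m n o → m + n + o ≡ n + (o + m)
    regroup = solve-∀

  A-high≤c : R + (SA ∸ hA) ≤ c
  A-high≤c = share-leaves-room {DA} {SA} R≤c

  B-high≤c : R + (SB ∸ hB) ≤ c
  B-high≤c = share-leaves-room {DB} {SB} R≤c

  A-below-z : R + (SA ∸ hA) + (Z ∸ hz) ≤ c
  A-below-z = below-z-top {R} {SA} {hA} {hB} {hz} {Z} {c} R-split
    (share-below-side {DA} {SA} {R} {c} (proj₁ demand-A) R≤c) A-high≤c Z+SA+hB≤c

  B-below-z : R + (SB ∸ hB) + (Z ∸ hz) ≤ c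
  B-below-z = below-z-top {R} {SB} {hB} {hA} {hz} {Z} {c} (trans R-split (cong (hz +_) (+-comm hA hB)))
    (share-below-side {DB} {SB} {R} {c} (proj₁ demand-B) R≤c) B-high≤c Z+SB+hA≤c

  top : ℕ
  top = c ∸ (Z ∸ hz)

  A-high≤top : R + (SA ∸ hA) ≤ top
  A-high≤top = m+n≤o⇒m≤o∸n _ A-below-z

  B-high≤top : R + (SB ∸ hB) ≤ top
  B-high≤top = m+n≤o⇒m≤o∸n _ B-below-z

  R≤top : R ≤ top
  R≤top = ≤-trans (m≤m+n R _) A-high≤top

  top-split : top + (Z ∸ hz) ≡ c
  top-split = m∸n+n≡m (≤-trans (m≤n+m (Z ∸ hz) _) A-below-z)

  module A = Side (wt ∘ a) (wt ∘ u) R c stA hA (λ j → ≤-trans (u-x-y j) ω≤c)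
                  (≤-reflexive stA+hA) (m≤m⊔n DA _) A-high≤c
  module B = Side (wt ∘ b) (wt ∘ w) R c 0 hB (λ j → ≤-trans (w-x-y j) ω≤c)
                  (≤-trans hB≤X (m≤m+n X Y)) (m≤m⊔n DB _) B-high≤c

  zColour : ℕ → ℕ
  zColour = lay hB hz top

  z-window : ∀ {r} → r < Z → InWindow hB hz top (Z ∸ hz) (zColour r)
  z-window r<Z = lay-window hB hz top r<Z

  z-bound : ∀ {r} → r < Z → zColour r < c
  z-bound r<Z with z-window r<Z
  ... | inj₁ (_ , ub) = <-≤-trans ub (≤-trans (≤-reflexive hB+hz) (≤-trans stA≤R R≤c))
  ... | inj₂ (_ , ub) = <-≤-trans ub (≤-reflexive top-split)

  z-injective : ∀ r r' → zColour r ≡ zColour r' → r ≡ r'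
  z-injective = lay-injective {hB} {hz} {top} (≤-trans (≤-reflexive hB+hz) (≤-trans stA≤R R≤top))

  above-R : ∀ {col col'} → R ≤ col → col' < R → col ≢ col'
  above-R R≤col col'<R = >⇒≢ (<-≤-trans col'<R R≤col)

  x-low : ∀ {r} → r < X → r < R
  x-low r<X = <-≤-trans r<X (m≤m+n X Y)

  y-low : ∀ {r} → r < Y → X + r < R
  y-low r<Y = +-monoʳ-< X r<Y

  x-y : ∀ {r r'} → r < X → r ≢ X + r'
  x-y r<X = <⇒≢ (<-≤-trans r<X (m≤m+n X _))

  a-x : ∀ i {r r'} → r < wt (a i) → r' < X → A.colA i r ≢ r'
  a-x i r<α r'<X = >⇒≢ (<-≤-trans r'<X (≤-trans (m≤m+n X _) (window-above-start (A.colA-window i r<α) stA≤R)))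

  a-z : ∀ i {r r'} → r < wt (a i) → r' < Z → A.colA i r ≢ zColour r'
  a-z i r<α r'<Z = windows-disjoint (A.colA-window i r<α) (z-window r'<Z)
    (inj₂ (≤-reflexive hB+hz)) (≤-trans (≤-reflexive stA+hA) R≤top)
    (≤-trans (≤-reflexive hB+hz) stA≤R) A-high≤top

  b-y : ∀ i {r r'} → r < wt (b i) → r' < Y → B.colA i r ≢ X + r'
  b-y i r<β r'<Y = window-avoids (B.colA-window i r<β) hB≤X ≤-refl (m≤m+n X _) (y-low r'<Y)

  b-z : ∀ i {r r'} → r < wt (b i) → r' < Z → B.colA i r ≢ zColour r'
  b-z i r<β r'<Z = windows-disjoint (B.colA-window i r<β) (z-window r'<Z)
    (inj₁ ≤-refl) (≤-trans hB≤X (≤-trans (m≤m+n X Y) R≤top))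
    (≤-trans (≤-reflexive hB+hz) stA≤R) B-high≤top

  colour : FV k ℓ → ℕ → ℕ
  colour (a i) = A.colA i
  colour (u j) = A.colU j
  colour (b i) = B.colA i
  colour (w j) = B.colU j
  colour x     = λ r → r
  colour y     = λ r → X + r
  colour z     = zColour

  bounded : ∀ t {r} → r < wt t → colour t r < c
  bounded (a i) = A.colA-bound i
  bounded (u j) = A.colU-bound j
  bounded (b i) = B.colA-bound i
  bounded (w j) = B.colU-bound j
  bounded x     = λ r<X → <-≤-trans (x-low r<X) R≤c
  bounded y     = λ r<Y → <-≤-trans (y-low r<Y) R≤c
  bounded z     = z-bound

  injective : ∀ t {r r'} → r < wt t → r' < wt t → colour t r ≡ colour t r' → r ≡ r'
  injective (a i) r< r'< e = proj₂ (A.colA-injective i i r< r'< e)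
  injective (u j) _  _   e = A.colU-injective j _ _ e
  injective (b i) r< r'< e = proj₂ (B.colA-injective i i r< r'< e)
  injective (w j) _  _   e = B.colU-injective j _ _ e
  injective x     _  _   e = e
  injective y     _  _   e = +-cancelˡ-≡ X _ _ e
  injective z     _  _   e = z-injective _ _ e

  separated : ∀ t t' {r r'} → FE t t' → r < wt t → r' < wt t' → colour t r ≢ colour t' r'
  separated (a i) (a j) i≢j  r< r'< = λ e → i≢j (proj₁ (A.colA-injective i j r< r'< e))
  separated (a i) (u j) refl r< r'< = ≢-sym (A.colU-avoids j r<)
  separated (a i) (b j) ()
  separated (a i) (w j) ()
  separated (a i) x     _    r< r'< = a-x i r< r'<
  separated (a i) y     ()
  separated (a i) z     _    r< r'< = a-z i r< r'<
  separated (u j) (a i) refl r< r'< = A.colU-avoids j r'<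
  separated (u i) (u j) ()
  separated (u i) (b j) ()
  separated (u i) (w j) ()
  separated (u j) x     _    r< r'< = above-R (A.colU-above j _) (x-low r'<)
  separated (u j) y     _    r< r'< = above-R (A.colU-above j _) (y-low r'<)
  separated (u j) z     ()
  separated (b i) (a j) ()
  separated (b i) (u j) ()
  separated (b i) (b j) i≢j  r< r'< = λ e → i≢j (proj₁ (B.colA-injective i j r< r'< e))
  separated (b i) (w j) refl r< r'< = ≢-sym (B.colU-avoids j r<)
  separated (b i) x     ()
  separated (b i) y     _    r< r'< = b-y i r< r'<
  separated (b i) z     _    r< r'< = b-z i r< r'<
  separated (w j) (a i) ()
  separated (w j) (u i) ()
  separated (w j) (b i) refl r< r'< = B.colU-avoids j r'<
  separated (w i) (w j) ()
  separated (w j) x     _    r< r'< = above-R (B.colU-above j _) (x-low r'<)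
  separated (w j) y     _    r< r'< = above-R (B.colU-above j _) (y-low r'<)
  separated (w j) z     ()
  separated x     (a i) _    r< r'< = ≢-sym (a-x i r'< r<)
  separated x     (u j) _    r< r'< = ≢-sym (above-R (A.colU-above j _) (x-low r<))
  separated x     (b i) ()
  separated x     (w j) _    r< r'< = ≢-sym (above-R (B.colU-above j _) (x-low r<))
  separated x     x     ()
  separated x     y     _    r< r'< = x-y r<
  separated x     z     ()
  separated y     (a i) ()
  separated y     (u j) _    r< r'< = ≢-sym (above-R (A.colU-above j _) (y-low r<))
  separated y     (b i) _    r< r'< = ≢-sym (b-y i r'< r<)
  separated y     (w j) _    r< r'< = ≢-sym (above-R (B.colU-above j _) (y-low r<))
  separated y     x     _    r< r'< = ≢-sym (x-y r'<)
  separated y     y     ()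
  separated y     z     ()
  separated z     (a i) _    r< r'< = ≢-sym (a-z i r'< r<)
  separated z     (u j) ()
  separated z     (b i) _    r< r'< = ≢-sym (b-z i r'< r<)
  separated z     (w j) ()
  separated z     x     ()
  separated z     y     ()
  separated z     z     ()

  palette : Palette FE wt c
  palette = record { colour = colour ; bounded = bounded ; injective = injective ; separated = separated }

FVCode : ℕ → ℕ → Set
FVCode k ℓ = Fin (suc k) ⊎ Fin k ⊎ Fin (suc ℓ) ⊎ Fin ℓ ⊎ Fin 3

encode : ∀ {k ℓ} → FV k ℓ → FVCode k ℓ
encode (a i) = inj₁ i
encode (u j) = inj₂ (inj₁ j)
encode (b i) = inj₂ (inj₂ (inj₁ i))
encode (w j) = inj₂ (inj₂ (inj₂ (inj₁ j)))
encode x     = inj₂ (inj₂ (inj₂ (inj₂ zero)))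
encode y     = inj₂ (inj₂ (inj₂ (inj₂ (suc zero))))
encode z     = inj₂ (inj₂ (inj₂ (inj₂ (suc (suc zero)))))

decode : ∀ {k ℓ} → FVCode k ℓ → FV k ℓ
decode (inj₁ i)                                   = a i
decode (inj₂ (inj₁ j))                            = u j
decode (inj₂ (inj₂ (inj₁ i)))                     = b i
decode (inj₂ (inj₂ (inj₂ (inj₁ j))))              = w j
decode (inj₂ (inj₂ (inj₂ (inj₂ zero))))           = x
decode (inj₂ (inj₂ (inj₂ (inj₂ (suc zero)))))     = y
decode (inj₂ (inj₂ (inj₂ (inj₂ (suc (suc _))))))  = z

decode-encode : ∀ {k ℓ} (t : FV k ℓ) → decode (encode t) ≡ t
decode-encode (a i) = refl
decode-encode (u j) = refl
decode-encode (b i) = refl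
decode-encode (w j) = refl
decode-encode x     = refl
decode-encode y     = refl
decode-encode z     = refl

encode-injective : ∀ {k ℓ} {t t' : FV k ℓ} → encode t ≡ encode t' → t ≡ t'
encode-injective {t = t} {t'} e = trans (sym (decode-encode t)) (trans (cong decode e) (decode-encode t'))

_≟FV_ : ∀ {k ℓ} → DecidableEquality (FV k ℓ)
_≟FV_ = via-injection (mk↣ encode-injective)
  (≡-dec Fin._≟_ (≡-dec Fin._≟_ (≡-dec Fin._≟_ (≡-dec Fin._≟_ Fin._≟_))))

FE-irreflexive : ∀ {k ℓ} (t : FV k ℓ) → ¬ FE t t
FE-irreflexive (a i) i≢i = i≢i refl
FE-irreflexive (b i) i≢i = i≢i refl
FE-irreflexive (u j) ()
FE-irreflexive (w j) ()
FE-irreflexive x     ()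
FE-irreflexive y     ()
FE-irreflexive z     ()

F-clique-bounds : ∀ {k ℓ n} {G : SimpleGraph n} {p : Fin n → FV k ℓ} (blowup : IsBlowupOfF k ℓ G p) →
  ∀ {ω} → IsCliqueNumber G ω → CliqueBounds (Blowup.weight _≟FV_ FE G p blowup) ω
F-clique-bounds {k} {ℓ} {G = G} {p} blowup {ω} icn = record
  { A+z   = apex-bound a z (λ _ _ i≢j → i≢j) (λ _ → tt) (λ _ → tt)
  ; A+x   = apex-bound a x (λ _ _ i≢j → i≢j) (λ _ → tt) (λ _ → tt)
  ; B+z   = apex-bound b z (λ _ _ i≢j → i≢j) (λ _ → tt) (λ _ → tt)
  ; B+y   = apex-bound b y (λ _ _ i≢j → i≢j) (λ _ → tt) (λ _ → tt)
  ; x+y   = pair-bound {x} {y} tt tt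
  ; a-u-x = λ j → triangle-bound {a (suc j)} {u j} {x} refl refl tt tt tt tt
  ; u-x-y = λ j → subst (_≤ ω) (+-assoc (weight (u j)) _ _) (triangle-bound {u j} {x} {y} tt tt tt tt tt tt)
  ; b-w-y = λ j → triangle-bound {b (suc j)} {w j} {y} refl refl tt tt tt tt
  ; w-x-y = λ j → subst (_≤ ω) (+-assoc (weight (w j)) _ _) (triangle-bound {w j} {x} {y} tt tt tt tt tt tt)
  }
  where
  open Blowup _≟FV_ FE G p blowup
  open Cliques FE-irreflexive icn

theorem5p12 : (k ℓ n : ℕ) (G : SimpleGraph n) (p : Fin n → FV k ℓ) →
    IsBlowupOfF k ℓ G p →
    (ω : ℕ) → IsCliqueNumber G ω →
    Colouring G (ceil5/4 ω)
theorem5p12 k ℓ n G p blowup ω icn =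
  palette-colouring (subst (Palette FE weight) (budget-split ω)
    (FColouring.palette weight (ω≤4*slack ω) (F-clique-bounds blowup icn)))
  where open Blowup _≟FV_ FE G p blowup
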